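{- For all integers $m\ge1$ and $i,j\ge0$, $$s_{2m-1,i,j}=t_{2m-1,2i-1,j}+t_{2m-1,2i,j}\qquad\text{and}\qquad s_{2m,i,j}=t_{2m,2i+1,j}+t_{2m,2i,j},$$ with the convention $t_{n,-1,j}=0$.
   Context: Let $D$ be the derivation (additive, with $D(uv)=D(u)v+uD(v)$) on $\mathbb{Z}[w,x,y,z]$ determined by $D(w)=wy$, $D(x)=yz$, $D(y)=xz$, $D(z)=xy$. The integers $t_{n,i,j}$ are defined by $D^{2m}(w)=w\sum_{i,j\ge0}t_{2m,i,j}\,x^iy^{2j}z^{2m-i-2j}$ and $D^{2m+1}(w)=w\sum_{i,j\ge0}t_{2m+1,i,j}\,x^iy^{2j+1}z^{2m-i-2j}$. The integers $s_{n,i,j}$ are the coefficients of the Schett polynomials $S_n=D^n(x)$ restricted to $\mathbb{Z}[x,y,z]$ (i.e. $D(x)=yz,D(y)=xz,D(z)=xy$): $S_{2m}=\sum_{i,j\ge0}s_{2m,i,j}\,x^{2i+1}y^{2j}z^{2m-2i-2j}$ and $S_{2m+1}=\sum_{i,j\ge0}s_{2m+1,i,j}\,x^{2i}y^{2j+1}z^{2m+1-2i-2j}$. -}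

module Defs where

open import Data.Nat as ℕ using (ℕ; zero; suc; _∸_; _≡ᵇ_; _≤ᵇ_)
open import Data.Integer as ℤ using (ℤ; +_; -[1+_])
open import Data.Bool using (Bool; true; false; _∧_; if_then_else_)
open import Data.List using (List; []; _∷_; _++_; concatMap)
open import Data.Product using (_×_; _,_)
open import Data.Sum using (_⊎_; inj₁; inj₂)
open import Function using (_∘_)

-- Polynomials in ℤ[w,x,y,z], represented sparsely as a (not necessarily
-- normalised) finite formal sum of terms  c · w^a x^b y^c z^d.
-- The polynomial denoted by a list is the sum of its terms.
record Term : Set where
  constructor term
  field
    coef : ℤ
    ew ex ey ez : ℕ

Poly : Set
Poly = List Term

wPoly : Poly
wPoly = term (+ 1) 1 0 0 0 ∷ []

xPoly : Poly
xPoly = term (+ 1) 0 1 0 0 ∷ []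

-- The derivation D with D(w)=wy, D(x)=yz, D(y)=xz, D(z)=xy, applied to one
-- monomial by the Leibniz rule:
--  D(w^a x^b y^c z^d) = a w^a x^b y^(c+1) z^d      (w^(a-1)·wy)
--                     + b w^a x^(b-1) y^(c+1) z^(d+1)
--                     + c w^a x^(b+1) y^(c-1) z^(d+1)
--                     + d w^a x^(b+1) y^(c+1) z^(d-1)
-- (a term with a zero factor in front has coefficient 0, so the ∸ is harmless).
DTerm : Term → Poly
DTerm (term k a b c d) =
    term (k ℤ.* + a) a b (suc c) d
  ∷ term (k ℤ.* + b) a (b ∸ 1) (suc c) (suc d)
  ∷ term (k ℤ.* + c) a (suc b) (c ∸ 1) (suc d)
  ∷ term (k ℤ.* + d) a (suc b) (suc c) (d ∸ 1)
  ∷ []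

D : Poly → Poly
D = concatMap DTerm

Dⁿ : ℕ → Poly → Poly
Dⁿ zero    p = p
Dⁿ (suc n) p = D (Dⁿ n p)

coeff : Poly → ℕ → ℕ → ℕ → ℕ → ℤ
coeff [] a b c d = + 0
coeff (term k a' b' c' d' ∷ p) a b c d =
  (if (a' ≡ᵇ a) ∧ (b' ≡ᵇ b) ∧ (c' ≡ᵇ c) ∧ (d' ≡ᵇ d) then k else + 0)
  ℤ.+ coeff p a b c d

parity : ℕ → ℕ ⊎ ℕ
parity zero = inj₁ 0
parity (suc n) with parity n
... | inj₁ m = inj₂ m
... | inj₂ m = inj₁ (suc m)

-- When i + 2j > 2m the monomial does not exist and the coefficient is 0.
t : ℕ → ℕ → ℕ → ℤ
t n i j with parity n
... | inj₁ m = if (i ℕ.+ 2 ℕ.* j) ≤ᵇ (2 ℕ.* m)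
                then coeff (Dⁿ n wPoly) 1 i (2 ℕ.* j) (2 ℕ.* m ∸ i ∸ 2 ℕ.* j)
                else + 0
... | inj₂ m = if (i ℕ.+ 2 ℕ.* j) ≤ᵇ (2 ℕ.* m)
                then coeff (Dⁿ n wPoly) 1 i (suc (2 ℕ.* j)) (2 ℕ.* m ∸ i ∸ 2 ℕ.* j)
                else + 0

tℤ : ℕ → ℤ → ℕ → ℤ
tℤ n (+ i)     j = t n i j
tℤ n -[1+ _ ] j = + 0

-- s_{n,i,j}: coefficients of the Schett polynomial S_n = D^n(x) (which lies in
-- ℤ[x,y,z], so we read off coefficients with w-exponent 0).
-- n = 2m:   coefficient of x^(2i+1) y^(2j) z^(2m-2i-2j);
-- n = 2m+1: coefficient of x^(2i) y^(2j+1) z^(2m+1-2i-2j).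
s : ℕ → ℕ → ℕ → ℤ
s n i j with parity n
... | inj₁ m = if (i ℕ.+ j) ≤ᵇ m
                then coeff (Dⁿ n xPoly) 0 (suc (2 ℕ.* i)) (2 ℕ.* j) (2 ℕ.* m ∸ 2 ℕ.* i ∸ 2 ℕ.* j)
                else + 0
... | inj₂ m = if (i ℕ.+ j) ≤ᵇ m
                then coeff (Dⁿ n xPoly) 0 (2 ℕ.* i) (suc (2 ℕ.* j)) (suc (2 ℕ.* m) ∸ 2 ℕ.* i ∸ 2 ℕ.* j)
                else + 0

-- Write T_n = D^n(w)/w ∈ ℤ[x,y,z]; then T_(n+1) = y T_n + D(T_n). Since D(x + z) = y(x + z),
-- the Leibniz rule gives D((x + z) T_n) = (x + z) T_(n+1), hence D^n(x) + D^n(z) = (x + z) T_n.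
-- Every application of D changes the x-degree of each monomial by ±1, so D^n(z) has no
-- monomial whose x-degree b has the parity of n + 1. For those monomials the coefficient of
-- x^b y^c z^d in S_n = D^n(x) is therefore the sum of the coefficients of x^(b-1) y^c z^d and
-- x^b y^c z^(d-1) in T_n, which is the theorem read off at the exponents defining s and t.
module Submission where

open import Defs
module _ where
  open import Data.Bool using (Bool; true; false; not; _∧_; if_then_else_)
  open import Data.Bool.Properties using (not-involutive; not-¬)
  open import Data.Integer as ℤ
    using (ℤ; +_; -[1+_]; 0ℤ; 1ℤ; -1ℤ; _+_; _*_; _-_; -_; _⊖_; _<_; -<+)
    renaming (suc to sucℤ; pred to predℤ)
  import Data.Integer.Properties as ℤ
  open import Data.Integer.Tactic.RingSolver using (solve-∀)
  open import Data.List using ([]; _∷_; _++_)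
  open import Data.Nat as ℕ using (ℕ; zero; suc; _≡ᵇ_; _≤ᵇ_; _∸_; _≤_)
  import Data.Nat.Properties as ℕ
  open import Data.Sum using (inj₁; inj₂)
  open import Function using (_∘_)
  open import Relation.Binary.PropositionalEquality
    using (_≡_; refl; sym; trans; cong; cong₂; subst; module ≡-Reasoning)
  open import Relation.Nullary using (contradiction)
  open import Relation.Nullary.Reflects using (Reflects; ofʸ; ofⁿ; fromEquivalence)
  open ≡-Reasoning

  -- Coefficients are indexed by integer exponents, so that lowering an exponent needs no
  -- truncated subtraction; they vanish at negative exponents.
  χ : Bool → ℤ
  χ b = if b then 1ℤ else 0ℤ

  δ : ℕ → ℤ → ℤ
  δ n (+ m)    = χ (n ≡ᵇ m)
  δ n -[1+ _ ] = 0ℤ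

  termCoeff : Term → ℤ → ℤ → ℤ → ℤ → ℤ
  termCoeff (term k a b c d) A B C D = k * (δ a A * (δ b B * (δ c C * δ d D)))

  coeffℤ : Poly → ℤ → ℤ → ℤ → ℤ → ℤ
  coeffℤ []      A B C D = 0ℤ
  coeffℤ (t ∷ p) A B C D = termCoeff t A B C D + coeffℤ p A B C D

  if-∧-χ : ∀ k x y z w →
    (if x ∧ y ∧ z ∧ w then k else 0ℤ) ≡ k * (χ x * (χ y * (χ z * χ w)))
  if-∧-χ k true  true  true  true  = sym (ℤ.*-identityʳ k)
  if-∧-χ k true  true  true  false = sym (ℤ.*-zeroʳ k)
  if-∧-χ k true  true  false _     = sym (ℤ.*-zeroʳ k)
  if-∧-χ k true  false _     _     = sym (ℤ.*-zeroʳ k)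
  if-∧-χ k false _     _     _     = sym (ℤ.*-zeroʳ k)

  coeffℤ-coeff : ∀ p a b c d → coeffℤ p (+ a) (+ b) (+ c) (+ d) ≡ coeff p a b c d
  coeffℤ-coeff []                       a b c d = refl
  coeffℤ-coeff (term k a′ b′ c′ d′ ∷ p) a b c d =
    cong₂ _+_ (sym (if-∧-χ k (a′ ≡ᵇ a) (b′ ≡ᵇ b) (c′ ≡ᵇ c) (d′ ≡ᵇ d))) (coeffℤ-coeff p a b c d)

  coeffℤ-x<0 : ∀ p A {B} C D → B < 0ℤ → coeffℤ p A B C D ≡ 0ℤ
  coeffℤ-x<0 []                   A C D B<0 = refl
  coeffℤ-x<0 (term k a b c d ∷ p) A { -[1+ _ ] } C D -<+ =
    cong₂ _+_ (absorb k (δ a A) (δ c C * δ d D)) (coeffℤ-x<0 p A C D -<+)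
    where
    absorb : ∀ k α ρ → k * (α * (0ℤ * ρ)) ≡ 0ℤ
    absorb = solve-∀

  coeffℤ-z<0 : ∀ p A B C {D} → D < 0ℤ → coeffℤ p A B C D ≡ 0ℤ
  coeffℤ-z<0 []                   A B C D<0 = refl
  coeffℤ-z<0 (term k a b c d ∷ p) A B C { -[1+ _ ] } -<+ =
    cong₂ _+_ (absorb k (δ a A) (δ b B) (δ c C)) (coeffℤ-z<0 p A B C -<+)
    where
    absorb : ∀ k α β γ → k * (α * (β * (γ * 0ℤ))) ≡ 0ℤ
    absorb = solve-∀

  δ-pred : ∀ n z → δ (suc n) z ≡ δ n (predℤ z)
  δ-pred n (+ zero)  = refl
  δ-pred n (+ suc m) = refl
  δ-pred n -[1+ m ]  = refl

  δ-scale : ∀ n z → z * δ n z ≡ + n * δ n z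
  δ-scale n -[1+ m ] = trans (ℤ.*-zeroʳ -[1+ m ]) (sym (ℤ.*-zeroʳ (+ n)))
  δ-scale n (+ m) with n ≡ᵇ m | ℕ.≡ᵇ⇒≡ n m
  ... | true  | n≡m = cong (λ k → + k * 1ℤ) (sym (n≡m _))
  ... | false | _   = trans (ℤ.*-zeroʳ (+ m)) (sym (ℤ.*-zeroʳ (+ n)))

  δ-deriv : ∀ n z → + n * δ (n ∸ 1) z ≡ sucℤ z * δ n (sucℤ z)
  δ-deriv zero    z = sym (trans (δ-scale 0 (sucℤ z)) (ℤ.*-zeroˡ (δ 0 (sucℤ z))))
  δ-deriv (suc n) z = begin
    + suc n * δ n z                ≡⟨ ℤ.*-distribʳ-+ (δ n z) 1ℤ (+ n) ⟩
    1ℤ * δ n z + + n * δ n z       ≡⟨ cong (_+_ (1ℤ * δ n z)) (sym (δ-scale n z)) ⟩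
    1ℤ * δ n z + z * δ n z         ≡⟨ ℤ.*-distribʳ-+ (δ n z) 1ℤ z ⟨
    sucℤ z * δ n z                 ≡⟨ cong (λ w → sucℤ z * δ n w) (ℤ.pred-suc z) ⟨
    sucℤ z * δ n (predℤ (sucℤ z))  ≡⟨ cong (sucℤ z *_) (δ-pred n (sucℤ z)) ⟨
    sucℤ z * δ (suc n) (sucℤ z)    ∎

  Coeffs : Set
  Coeffs = ℤ → ℤ → ℤ → ℤ

  infix  4 _≐_
  infixl 6 _⊕_

  _≐_ : Coeffs → Coeffs → Set
  f ≐ g = ∀ b c d → f b c d ≡ g b c d

  _⊕_ : Coeffs → Coeffs → Coeffs
  (f ⊕ g) b c d = f b c d + g b c d

  -- For g ∈ ℤ[x,y,z], Dxyz g and Dw A g are the coefficients of D(g) and of D(w^A g)/w^A.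
  Dxyz : Coeffs → Coeffs
  Dxyz g b c d = sucℤ b * g (sucℤ b) (predℤ c) (predℤ d)
               + sucℤ c * g (predℤ b) (sucℤ c) (predℤ d)
               + sucℤ d * g (predℤ b) (predℤ c) (sucℤ d)

  Dw : ℤ → Coeffs → Coeffs
  Dw A g b c d = A * g b (predℤ c) d + Dxyz g b c d

  mulXZ : Coeffs → Coeffs
  mulXZ g b c d = g (predℤ b) c d + g b c (predℤ d)

  Dxyz-cong : ∀ {f g} → f ≐ g → Dxyz f ≐ Dxyz g
  Dxyz-cong f≐g b c d = cong₂ _+_
    (cong₂ _+_ (cong (sucℤ b *_) (f≐g _ _ _)) (cong (sucℤ c *_) (f≐g _ _ _)))
    (cong (sucℤ d *_) (f≐g _ _ _))

  mulXZ-cong : ∀ {f g} → f ≐ g → mulXZ f ≐ mulXZ g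
  mulXZ-cong f≐g b c d = cong₂ _+_ (f≐g _ _ _) (f≐g _ _ _)

  Dxyz-⊕ : ∀ f g → Dxyz (f ⊕ g) ≐ Dxyz f ⊕ Dxyz g
  Dxyz-⊕ f g b c d = distrib (sucℤ b) (sucℤ c) (sucℤ d)
    (f (sucℤ b) (predℤ c) (predℤ d)) (f (predℤ b) (sucℤ c) (predℤ d)) (f (predℤ b) (predℤ c) (sucℤ d))
    (g (sucℤ b) (predℤ c) (predℤ d)) (g (predℤ b) (sucℤ c) (predℤ d)) (g (predℤ b) (predℤ c) (sucℤ d))
    where
    distrib : ∀ u v w f₁ f₂ f₃ g₁ g₂ g₃ →
      u * (f₁ + g₁) + v * (f₂ + g₂) + w * (f₃ + g₃) ≡ (u * f₁ + v * f₂ + w * f₃) + (u * g₁ + v * g₂ + w * g₃)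
    distrib = solve-∀

  Dw-⊕ : ∀ A f g → Dw A (f ⊕ g) ≐ Dw A f ⊕ Dw A g
  Dw-⊕ A f g b c d = begin
    A * (f b (predℤ c) d + g b (predℤ c) d) + Dxyz (f ⊕ g) b c d
      ≡⟨ cong (λ x → A * (f b (predℤ c) d + g b (predℤ c) d) + x) (Dxyz-⊕ f g b c d) ⟩
    A * (f b (predℤ c) d + g b (predℤ c) d) + (Dxyz f b c d + Dxyz g b c d)
      ≡⟨ distrib A (f b (predℤ c) d) (g b (predℤ c) d) (Dxyz f b c d) (Dxyz g b c d) ⟩
    (A * f b (predℤ c) d + Dxyz f b c d) + (A * g b (predℤ c) d + Dxyz g b c d) ∎
    where
    distrib : ∀ A f g x y → A * (f + g) + (x + y) ≡ (A * f + x) + (A * g + y)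
    distrib = solve-∀

  -- The Leibniz rule together with D(x + z) = y(x + z).
  Dxyz-mulXZ : ∀ g → Dxyz (mulXZ g) ≐ mulXZ (Dw 1ℤ g)
  Dxyz-mulXZ g b c d
    rewrite ℤ.pred-suc b | ℤ.suc-pred b | ℤ.pred-suc d | ℤ.suc-pred d =
    regroup b c d (g b (predℤ c) (predℤ d)) (g (sucℤ b) (predℤ c) (predℤ (predℤ d)))
      (g (predℤ (predℤ b)) (sucℤ c) (predℤ d)) (g (predℤ b) (sucℤ c) (predℤ (predℤ d)))
      (g (predℤ (predℤ b)) (predℤ c) (sucℤ d)) (g (predℤ b) (predℤ c) d)
    where
    regroup : ∀ b c d x₁ x₂ x₃ x₄ x₅ x₆ →
      (1ℤ + b) * (x₁ + x₂) + (1ℤ + c) * (x₃ + x₄) + (1ℤ + d) * (x₅ + x₆)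
      ≡ (1ℤ * x₆ + (b * x₁ + (1ℤ + c) * x₃ + (1ℤ + d) * x₅))
        + (1ℤ * x₁ + ((1ℤ + b) * x₂ + (1ℤ + c) * x₄ + d * x₆))
    regroup = solve-∀

  termCoeff-∂w : ∀ k a b c d A B C D →
    termCoeff (term (k * + a) a b (suc c) d) A B C D ≡ A * termCoeff (term k a b c d) A B (predℤ C) D
  termCoeff-∂w k a b c d A B C D rewrite δ-pred c C = begin
    k * + a * (δ a A * ρ)         ≡⟨ pull k (+ a) (δ a A) ρ ⟩
    (+ a * δ a A) * (k * ρ)       ≡⟨ cong (_* (k * ρ)) (δ-scale a A) ⟨
    (A * δ a A) * (k * ρ)         ≡⟨ push k A (δ a A) ρ ⟩
    A * (k * (δ a A * ρ))         ∎
    where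
    ρ = δ b B * (δ c (predℤ C) * δ d D)
    pull : ∀ k x y ρ → k * x * (y * ρ) ≡ (x * y) * (k * ρ)
    pull = solve-∀
    push : ∀ k u v ρ → (u * v) * (k * ρ) ≡ u * (k * (v * ρ))
    push = solve-∀

  termCoeff-∂x : ∀ k a b c d A B C D →
    termCoeff (term (k * + b) a (b ∸ 1) (suc c) (suc d)) A B C D
      ≡ sucℤ B * termCoeff (term k a b c d) A (sucℤ B) (predℤ C) (predℤ D)
  termCoeff-∂x k a b c d A B C D rewrite δ-pred c C | δ-pred d D = begin
    k * + b * (α * (δ (b ∸ 1) B * ρ))            ≡⟨ pull k (+ b) α (δ (b ∸ 1) B) ρ ⟩
    (+ b * δ (b ∸ 1) B) * (k * (α * ρ))          ≡⟨ cong (_* (k * (α * ρ))) (δ-deriv b B) ⟩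
    (sucℤ B * δ b (sucℤ B)) * (k * (α * ρ))      ≡⟨ push k (sucℤ B) α (δ b (sucℤ B)) ρ ⟩
    sucℤ B * (k * (α * (δ b (sucℤ B) * ρ)))      ∎
    where
    α = δ a A
    ρ = δ c (predℤ C) * δ d (predℤ D)
    pull : ∀ k x α y ρ → k * x * (α * (y * ρ)) ≡ (x * y) * (k * (α * ρ))
    pull = solve-∀
    push : ∀ k u α v ρ → (u * v) * (k * (α * ρ)) ≡ u * (k * (α * (v * ρ)))
    push = solve-∀

  termCoeff-∂y : ∀ k a b c d A B C D →
    termCoeff (term (k * + c) a (suc b) (c ∸ 1) (suc d)) A B C D
      ≡ sucℤ C * termCoeff (term k a b c d) A (predℤ B) (sucℤ C) (predℤ D)
  termCoeff-∂y k a b c d A B C D rewrite δ-pred b B | δ-pred d D = begin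
    k * + c * (α * (β * (δ (c ∸ 1) C * ε)))        ≡⟨ pull k (+ c) α β (δ (c ∸ 1) C) ε ⟩
    (+ c * δ (c ∸ 1) C) * (k * (α * (β * ε)))      ≡⟨ cong (_* (k * (α * (β * ε)))) (δ-deriv c C) ⟩
    (sucℤ C * δ c (sucℤ C)) * (k * (α * (β * ε)))  ≡⟨ push k (sucℤ C) α β (δ c (sucℤ C)) ε ⟩
    sucℤ C * (k * (α * (β * (δ c (sucℤ C) * ε))))  ∎
    where
    α = δ a A
    β = δ b (predℤ B)
    ε = δ d (predℤ D)
    pull : ∀ k x α β y ε → k * x * (α * (β * (y * ε))) ≡ (x * y) * (k * (α * (β * ε)))
    pull = solve-∀
    push : ∀ k u α β v ε → (u * v) * (k * (α * (β * ε))) ≡ u * (k * (α * (β * (v * ε))))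
    push = solve-∀

  termCoeff-∂z : ∀ k a b c d A B C D →
    termCoeff (term (k * + d) a (suc b) (suc c) (d ∸ 1)) A B C D
      ≡ sucℤ D * termCoeff (term k a b c d) A (predℤ B) (predℤ C) (sucℤ D)
  termCoeff-∂z k a b c d A B C D rewrite δ-pred b B | δ-pred c C = begin
    k * + d * (α * (β * (γ * δ (d ∸ 1) D)))        ≡⟨ pull k (+ d) α β γ (δ (d ∸ 1) D) ⟩
    (+ d * δ (d ∸ 1) D) * (k * (α * (β * γ)))      ≡⟨ cong (_* (k * (α * (β * γ)))) (δ-deriv d D) ⟩
    (sucℤ D * δ d (sucℤ D)) * (k * (α * (β * γ)))  ≡⟨ push k (sucℤ D) α β γ (δ d (sucℤ D)) ⟩
    sucℤ D * (k * (α * (β * (γ * δ d (sucℤ D)))))  ∎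
    where
    α = δ a A
    β = δ b (predℤ B)
    γ = δ c (predℤ C)
    pull : ∀ k x α β γ y → k * x * (α * (β * (γ * y))) ≡ (x * y) * (k * (α * (β * γ)))
    pull = solve-∀
    push : ∀ k u α β γ v → (u * v) * (k * (α * (β * γ))) ≡ u * (k * (α * (β * (γ * v))))
    push = solve-∀

  coeffℤ-++ : ∀ p q A → coeffℤ (p ++ q) A ≐ coeffℤ p A ⊕ coeffℤ q A
  coeffℤ-++ []      q A b c d = sym (ℤ.+-identityˡ _)
  coeffℤ-++ (t ∷ p) q A b c d =
    trans (cong (_+_ (termCoeff t A b c d)) (coeffℤ-++ p q A b c d)) (sym (ℤ.+-assoc (termCoeff t A b c d) _ _))

  coeffℤ-DTerm : ∀ t A → coeffℤ (DTerm t) A ≐ Dw A (termCoeff t A)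
  coeffℤ-DTerm (term k a b c d) A B C D =
    trans (cong₂ _+_ (termCoeff-∂w k a b c d A B C D)
            (cong₂ _+_ (termCoeff-∂x k a b c d A B C D)
              (cong₂ _+_ (termCoeff-∂y k a b c d A B C D)
                (cong (_+ 0ℤ) (termCoeff-∂z k a b c d A B C D)))))
          (reassoc (A * f B (predℤ C) D) (sucℤ B * f (sucℤ B) (predℤ C) (predℤ D))
            (sucℤ C * f (predℤ B) (sucℤ C) (predℤ D)) (sucℤ D * f (predℤ B) (predℤ C) (sucℤ D)))
    where
    f = termCoeff (term k a b c d) A
    reassoc : ∀ x₁ x₂ x₃ x₄ → x₁ + (x₂ + (x₃ + (x₄ + 0ℤ))) ≡ x₁ + (x₂ + x₃ + x₄)
    reassoc = solve-∀

  coeffℤ-D : ∀ p A → coeffℤ (D p) A ≐ Dw A (coeffℤ p A)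
  coeffℤ-D []      A b c d = sym (vanish A (sucℤ b) (sucℤ c) (sucℤ d))
    where
    vanish : ∀ A u v w → A * 0ℤ + (u * 0ℤ + v * 0ℤ + w * 0ℤ) ≡ 0ℤ
    vanish = solve-∀
  coeffℤ-D (t ∷ p) A b c d = begin
    coeffℤ (DTerm t ++ D p) A b c d
      ≡⟨ coeffℤ-++ (DTerm t) (D p) A b c d ⟩
    coeffℤ (DTerm t) A b c d + coeffℤ (D p) A b c d
      ≡⟨ cong₂ _+_ (coeffℤ-DTerm t A b c d) (coeffℤ-D p A b c d) ⟩
    Dw A (termCoeff t A) b c d + Dw A (coeffℤ p A) b c d
      ≡⟨ Dw-⊕ A (termCoeff t A) (coeffℤ p A) b c d ⟨
    Dw A (coeffℤ (t ∷ p) A) b c d ∎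

  coeffℤ-D-w⁰ : ∀ p → coeffℤ (D p) 0ℤ ≐ Dxyz (coeffℤ p 0ℤ)
  coeffℤ-D-w⁰ p b c d = trans (coeffℤ-D p 0ℤ b c d) (ℤ.+-identityˡ _)

  zPoly : Poly
  zPoly = term 1ℤ 0 0 0 1 ∷ []

  T S Z : ℕ → Coeffs
  T n = coeffℤ (Dⁿ n wPoly) 1ℤ
  S n = coeffℤ (Dⁿ n xPoly) 0ℤ
  Z n = coeffℤ (Dⁿ n zPoly) 0ℤ

  S⊕Z≐mulXZ-T : ∀ n → S n ⊕ Z n ≐ mulXZ (T n)
  S⊕Z≐mulXZ-T zero    b c d rewrite δ-pred 0 b | δ-pred 0 d = refl
  S⊕Z≐mulXZ-T (suc n) b c d = begin
    S (suc n) b c d + Z (suc n) b c d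
      ≡⟨ cong₂ _+_ (coeffℤ-D-w⁰ (Dⁿ n xPoly) b c d) (coeffℤ-D-w⁰ (Dⁿ n zPoly) b c d) ⟩
    Dxyz (S n) b c d + Dxyz (Z n) b c d
      ≡⟨ Dxyz-⊕ (S n) (Z n) b c d ⟨
    Dxyz (S n ⊕ Z n) b c d
      ≡⟨ Dxyz-cong (S⊕Z≐mulXZ-T n) b c d ⟩
    Dxyz (mulXZ (T n)) b c d
      ≡⟨ Dxyz-mulXZ (T n) b c d ⟩
    mulXZ (Dw 1ℤ (T n)) b c d
      ≡⟨ mulXZ-cong (coeffℤ-D (Dⁿ n wPoly) 1ℤ) b c d ⟨
    mulXZ (T (suc n)) b c d ∎

  isEven : ℕ → Bool
  isEven zero    = true
  isEven (suc n) = not (isEven n)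

  isEvenℤ : ℤ → Bool
  isEvenℤ (+ n)    = isEven n
  isEvenℤ -[1+ n ] = not (isEven n)

  isEven-double : ∀ k → isEven (2 ℕ.* k) ≡ true
  isEven-double zero    = refl
  isEven-double (suc k) rewrite ℕ.+-suc k (k ℕ.+ 0) | isEven-double k = refl

  isEvenℤ-suc : ∀ z → isEvenℤ (sucℤ z) ≡ not (isEvenℤ z)
  isEvenℤ-suc (+ n)        = refl
  isEvenℤ-suc -[1+ zero ]  = refl
  isEvenℤ-suc -[1+ suc n ] = sym (not-involutive (not (isEven n)))

  isEvenℤ-pred : ∀ z → isEvenℤ (predℤ z) ≡ not (isEvenℤ z)
  isEvenℤ-pred (+ zero)  = refl
  isEvenℤ-pred (+ suc n) = sym (not-involutive (isEven n))
  isEvenℤ-pred -[1+ n ]  = refl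

  δ-parity : ∀ n z → isEvenℤ z ≡ not (isEven n) → δ n z ≡ 0ℤ
  δ-parity n -[1+ m ] _ = refl
  δ-parity n (+ m) m-parity with n ≡ᵇ m | ℕ.≡ᵇ⇒≡ n m
  ... | true  | n≡m = contradiction m-parity (not-¬ (cong isEven (sym (n≡m _))))
  ... | false | _   = refl

  VanishesOn : Bool → Coeffs → Set
  VanishesOn β g = ∀ b c d → isEvenℤ b ≡ β → g b c d ≡ 0ℤ

  Dxyz-flip : ∀ {β g} → VanishesOn β g → VanishesOn (not β) (Dxyz g)
  Dxyz-flip {β} {g} g-vanishes b c d b≡¬β = begin
    sucℤ b * g (sucℤ b) (predℤ c) (predℤ d)
      + sucℤ c * g (predℤ b) (sucℤ c) (predℤ d)
      + sucℤ d * g (predℤ b) (predℤ c) (sucℤ d)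
      ≡⟨ cong₂ _+_ (cong₂ _+_ (cong (sucℤ b *_) (g-vanishes _ _ _ suc-b≡β))
                              (cong (sucℤ c *_) (g-vanishes _ _ _ pred-b≡β)))
                   (cong (sucℤ d *_) (g-vanishes _ _ _ pred-b≡β)) ⟩
    sucℤ b * 0ℤ + sucℤ c * 0ℤ + sucℤ d * 0ℤ
      ≡⟨ vanish (sucℤ b) (sucℤ c) (sucℤ d) ⟩
    0ℤ ∎
    where
    flipped : ∀ {x} → x ≡ not (isEvenℤ b) → x ≡ β
    flipped x≡ = trans x≡ (trans (cong not b≡¬β) (not-involutive β))
    suc-b≡β : isEvenℤ (sucℤ b) ≡ β
    suc-b≡β = flipped (isEvenℤ-suc b)
    pred-b≡β : isEvenℤ (predℤ b) ≡ β
    pred-b≡β = flipped (isEvenℤ-pred b)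
    vanish : ∀ u v w → u * 0ℤ + v * 0ℤ + w * 0ℤ ≡ 0ℤ
    vanish = solve-∀

  coeffℤ-D-flip : ∀ {β} p → VanishesOn β (coeffℤ p 0ℤ) → VanishesOn (not β) (coeffℤ (D p) 0ℤ)
  coeffℤ-D-flip p p-vanishes b c d h = trans (coeffℤ-D-w⁰ p b c d) (Dxyz-flip p-vanishes b c d h)

  Z-vanishes : ∀ n → VanishesOn (not (isEven n)) (Z n)
  Z-vanishes zero    b c d b-odd rewrite δ-parity 0 b b-odd = refl
  Z-vanishes (suc n) = coeffℤ-D-flip (Dⁿ n zPoly) (Z-vanishes n)

  S≐mulXZ-T : ∀ n b c d → isEvenℤ b ≡ not (isEven n) → S n b c d ≡ mulXZ (T n) b c d
  S≐mulXZ-T n b c d b-parity = begin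
    S n b c d              ≡⟨ ℤ.+-identityʳ (S n b c d) ⟨
    S n b c d + 0ℤ         ≡⟨ cong (_+_ (S n b c d)) (Z-vanishes n b c d b-parity) ⟨
    S n b c d + Z n b c d  ≡⟨ S⊕Z≐mulXZ-T n b c d ⟩
    mulXZ (T n) b c d      ∎

  sub-sub≡⊖ : ∀ m n₁ n₂ → + m - + n₁ - + n₂ ≡ m ⊖ (n₁ ℕ.+ n₂)
  sub-sub≡⊖ m n₁ n₂ = begin
    + m - + n₁ - + n₂          ≡⟨ ℤ.+-assoc (+ m) (- + n₁) (- + n₂) ⟩
    + m + (- + n₁ + - + n₂)    ≡⟨ cong (_+_ (+ m)) (ℤ.neg-distrib-+ (+ n₁) (+ n₂)) ⟨
    + m - (+ n₁ + + n₂)        ≡⟨ cong (λ x → + m - x) (ℤ.pos-+ n₁ n₂) ⟨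
    + m - + (n₁ ℕ.+ n₂)        ≡⟨ ℤ.[+m]-[+n]≡m⊖n m (n₁ ℕ.+ n₂) ⟩
    m ⊖ (n₁ ℕ.+ n₂)            ∎

  coeff-guarded : ∀ p a b c m n₁ n₂ {g} → Reflects (n₁ ℕ.+ n₂ ≤ m) g →
    (if g then coeff p a b c (m ∸ n₁ ∸ n₂) else 0ℤ) ≡ coeffℤ p (+ a) (+ b) (+ c) (+ m - + n₁ - + n₂)
  coeff-guarded p a b c m n₁ n₂ (ofʸ n≤m) = begin
    coeff p a b c (m ∸ n₁ ∸ n₂)                   ≡⟨ coeffℤ-coeff p a b c (m ∸ n₁ ∸ n₂) ⟨
    coeffℤ p (+ a) (+ b) (+ c) (+ (m ∸ n₁ ∸ n₂))  ≡⟨ cong (coeffℤ p (+ a) (+ b) (+ c)) exponent ⟩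
    coeffℤ p (+ a) (+ b) (+ c) (+ m - + n₁ - + n₂) ∎
    where
    exponent : + (m ∸ n₁ ∸ n₂) ≡ + m - + n₁ - + n₂
    exponent = begin
      + (m ∸ n₁ ∸ n₂)       ≡⟨ cong +_ (ℕ.∸-+-assoc m n₁ n₂) ⟩
      + (m ∸ (n₁ ℕ.+ n₂))   ≡⟨ ℤ.⊖-≥ n≤m ⟨
      m ⊖ (n₁ ℕ.+ n₂)       ≡⟨ sub-sub≡⊖ m n₁ n₂ ⟨
      + m - + n₁ - + n₂     ∎
  coeff-guarded p a b c m n₁ n₂ (ofⁿ n≰m) = sym (coeffℤ-z<0 p (+ a) (+ b) (+ c) exponent<0)
    where
    n = n₁ ℕ.+ n₂
    exponent<0 : + m - + n₁ - + n₂ < 0ℤ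
    exponent<0 rewrite sub-sub≡⊖ m n₁ n₂ | sym (ℤ.n⊖n≡0 n) = ℤ.⊖-monoˡ-< n (ℕ.≰⇒> n≰m)

  double-≤ : ∀ i j {m} → i ℕ.+ j ≤ m → 2 ℕ.* i ℕ.+ 2 ℕ.* j ≤ 2 ℕ.* m
  double-≤ i j i+j≤m rewrite sym (ℕ.*-distribˡ-+ 2 i j) = ℕ.*-monoʳ-≤ 2 i+j≤m

  halve-≤ : ∀ i j {m} → 2 ℕ.* i ℕ.+ 2 ℕ.* j ≤ suc (2 ℕ.* m) → i ℕ.+ j ≤ m
  halve-≤ i j {m} h rewrite sym (ℕ.*-distribˡ-+ 2 i j) =
    ℕ.s≤s⁻¹ (ℕ.*-cancelˡ-< 2 (i ℕ.+ j) (suc m) (subst (2 ℕ.* (i ℕ.+ j) ℕ.<_) (sym (ℕ.*-suc 2 m)) (ℕ.s≤s h)))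

  ≤ᵇ-reflects-double : ∀ i j m → Reflects (2 ℕ.* i ℕ.+ 2 ℕ.* j ≤ 2 ℕ.* m) (i ℕ.+ j ≤ᵇ m)
  ≤ᵇ-reflects-double i j m =
    fromEquivalence (double-≤ i j ∘ ℕ.≤ᵇ⇒≤ (i ℕ.+ j) m) (ℕ.≤⇒≤ᵇ ∘ halve-≤ i j ∘ ℕ.m≤n⇒m≤1+n)

  ≤ᵇ-reflects-double-suc : ∀ i j m → Reflects (2 ℕ.* i ℕ.+ 2 ℕ.* j ≤ suc (2 ℕ.* m)) (i ℕ.+ j ≤ᵇ m)
  ≤ᵇ-reflects-double-suc i j m =
    fromEquivalence (ℕ.m≤n⇒m≤1+n ∘ double-≤ i j ∘ ℕ.≤ᵇ⇒≤ (i ℕ.+ j) m) (ℕ.≤⇒≤ᵇ ∘ halve-≤ i j)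

  parity-double : ∀ k → parity (2 ℕ.* k) ≡ inj₁ k
  parity-double zero    = refl
  parity-double (suc k) rewrite ℕ.+-suc k (k ℕ.+ 0) | parity-double k = refl

  parity-suc-double : ∀ k → parity (suc (2 ℕ.* k)) ≡ inj₂ k
  parity-suc-double k rewrite parity-double k = refl

  tℤ-even : ∀ n {m} → parity n ≡ inj₁ m → ∀ b j →
    tℤ n b j ≡ T n b (+ (2 ℕ.* j)) (+ (2 ℕ.* m) - b - + (2 ℕ.* j))
  tℤ-even n _  -[1+ _ ] j = sym (coeffℤ-x<0 (Dⁿ n wPoly) 1ℤ _ _ -<+)
  tℤ-even n eq (+ i)    j with parity n | eq
  ... | inj₁ m | refl =
    coeff-guarded (Dⁿ n wPoly) 1 i (2 ℕ.* j) (2 ℕ.* m) i (2 ℕ.* j) (ℕ.≤ᵇ-reflects-≤ _ _)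

  tℤ-odd : ∀ n {m} → parity n ≡ inj₂ m → ∀ b j →
    tℤ n b j ≡ T n b (+ suc (2 ℕ.* j)) (+ (2 ℕ.* m) - b - + (2 ℕ.* j))
  tℤ-odd n _  -[1+ _ ] j = sym (coeffℤ-x<0 (Dⁿ n wPoly) 1ℤ _ _ -<+)
  tℤ-odd n eq (+ i)    j with parity n | eq
  ... | inj₂ m | refl =
    coeff-guarded (Dⁿ n wPoly) 1 i (suc (2 ℕ.* j)) (2 ℕ.* m) i (2 ℕ.* j) (ℕ.≤ᵇ-reflects-≤ _ _)

  s-even : ∀ n {m} → parity n ≡ inj₁ m → ∀ i j →
    s n i j ≡ S n (+ suc (2 ℕ.* i)) (+ (2 ℕ.* j)) (+ (2 ℕ.* m) - + (2 ℕ.* i) - + (2 ℕ.* j))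
  s-even n eq i j with parity n | eq
  ... | inj₁ m | refl =
    coeff-guarded (Dⁿ n xPoly) 0 (suc (2 ℕ.* i)) (2 ℕ.* j) (2 ℕ.* m) (2 ℕ.* i) (2 ℕ.* j)
      (≤ᵇ-reflects-double i j m)

  s-odd : ∀ n {m} → parity n ≡ inj₂ m → ∀ i j →
    s n i j ≡ S n (+ (2 ℕ.* i)) (+ suc (2 ℕ.* j)) (+ suc (2 ℕ.* m) - + (2 ℕ.* i) - + (2 ℕ.* j))
  s-odd n eq i j with parity n | eq
  ... | inj₂ m | refl =
    coeff-guarded (Dⁿ n xPoly) 0 (2 ℕ.* i) (suc (2 ℕ.* j)) (suc (2 ℕ.* m)) (2 ℕ.* i) (2 ℕ.* j)
      (≤ᵇ-reflects-double-suc i j m)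

  odd-case : ∀ k i j → let n = suc (2 ℕ.* k) in
    s n i j ≡ tℤ n (+ (2 ℕ.* i) - 1ℤ) j + t n (2 ℕ.* i) j
  odd-case k i j = begin
    s n i j
      ≡⟨ s-odd n n-odd i j ⟩
    S n I Y (1ℤ + K - I - J)
      ≡⟨ S≐mulXZ-T n I Y (1ℤ + K - I - J) I-parity ⟩
    T n (predℤ I) Y (1ℤ + K - I - J) + T n I Y (predℤ (1ℤ + K - I - J))
      ≡⟨ cong₂ _+_ (cong₂ (λ b d → T n b Y d) (pred≡-1 I) (shift-x K I J)) (cong (T n I Y) (shift-z K I J)) ⟩
    T n (I - 1ℤ) Y (K - (I - 1ℤ) - J) + T n I Y (K - I - J)
      ≡⟨ cong₂ _+_ (tℤ-odd n n-odd (I - 1ℤ) j) (tℤ-odd n n-odd I j) ⟨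
    tℤ n (I - 1ℤ) j + t n (2 ℕ.* i) j ∎
    where
    n = suc (2 ℕ.* k)
    n-odd = parity-suc-double k
    I = + (2 ℕ.* i)
    J = + (2 ℕ.* j)
    K = + (2 ℕ.* k)
    Y = + suc (2 ℕ.* j)
    I-parity : isEven (2 ℕ.* i) ≡ not (not (isEven (2 ℕ.* k)))
    I-parity = trans (isEven-double i) (cong (not ∘ not) (sym (isEven-double k)))
    -- The ring solver does not unfold predℤ, so it is written out as -1ℤ + _.
    pred≡-1 : ∀ I → -1ℤ + I ≡ I - 1ℤ
    pred≡-1 = solve-∀
    shift-x : ∀ K I J → 1ℤ + K - I - J ≡ K - (I - 1ℤ) - J
    shift-x = solve-∀
    shift-z : ∀ K I J → -1ℤ + (1ℤ + K - I - J) ≡ K - I - J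
    shift-z = solve-∀

  even-case : ∀ m i j → let n = 2 ℕ.* m in
    s n i j ≡ t n (2 ℕ.* i ℕ.+ 1) j + t n (2 ℕ.* i) j
  even-case m i j = begin
    s n i j
      ≡⟨ s-even n n-even i j ⟩
    S n (1ℤ + I) J (M - I - J)
      ≡⟨ S≐mulXZ-T n (1ℤ + I) J (M - I - J) (cong not (trans (isEven-double i) (sym (isEven-double m)))) ⟩
    T n (predℤ (1ℤ + I)) J (M - I - J) + T n (1ℤ + I) J (predℤ (M - I - J))
      ≡⟨ ℤ.+-comm (T n (predℤ (1ℤ + I)) J (M - I - J)) _ ⟩
    T n (1ℤ + I) J (predℤ (M - I - J)) + T n (predℤ (1ℤ + I)) J (M - I - J)
      ≡⟨ cong₂ _+_ (cong (T n (1ℤ + I) J) (shift-z M I J)) (cong (λ b → T n b J (M - I - J)) (ℤ.pred-suc I)) ⟩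
    T n (1ℤ + I) J (M - (1ℤ + I) - J) + T n I J (M - I - J)
      ≡⟨ cong₂ _+_ (tℤ-even n n-even (1ℤ + I) j) (tℤ-even n n-even I j) ⟨
    t n (suc (2 ℕ.* i)) j + t n (2 ℕ.* i) j
      ≡⟨ cong (λ x → t n x j + t n (2 ℕ.* i) j) (ℕ.+-comm 1 (2 ℕ.* i)) ⟩
    t n (2 ℕ.* i ℕ.+ 1) j + t n (2 ℕ.* i) j ∎
    where
    n = 2 ℕ.* m
    n-even = parity-double m
    I = + (2 ℕ.* i)
    J = + (2 ℕ.* j)
    M = + (2 ℕ.* m)
    shift-z : ∀ M I J → -1ℤ + (M - I - J) ≡ M - (1ℤ + I) - J
    shift-z = solve-∀

open import Data.Nat using (ℕ; _≤_; _*_; _∸_; _+_; suc)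
import Data.Nat.Properties as ℕ
open import Data.Integer as ℤ using (+_)
open import Data.Product using (_×_; _,_)
open import Relation.Binary.PropositionalEquality using (_≡_; sym; cong; subst)

mainTheorem13 : (m i j : ℕ) → 1 ≤ m →
    (s (2 * m ∸ 1) i j ≡ tℤ (2 * m ∸ 1) ((+ (2 * i)) ℤ.- (+ 1)) j ℤ.+ t (2 * m ∸ 1) (2 * i) j)
    × (s (2 * m) i j ≡ t (2 * m) (2 * i + 1) j ℤ.+ t (2 * m) (2 * i) j)
mainTheorem13 (suc k) i j _ =
  subst (λ n → s n i j ≡ tℤ n ((+ (2 * i)) ℤ.- (+ 1)) j ℤ.+ t n (2 * i) j)
        (cong (_∸ 1) (sym (ℕ.*-suc 2 k)))
        (odd-case k i j)
  , even-case (suc k) i j
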